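{- Let $G=(L\cup R,E)$ be a bipartite graph, let $H\subseteq E$ be an EDBS of $G$, and let $U\subseteq E\setminus H$ be the set of edges that are underfull w.r.t. $H$. Then either $\mu(G)\le(1/\epsilon)\cdot\mu(H)$ or $\mu(G)\le(1+\Theta(\epsilon))\cdot\mu(H\cup U)$.
   Context: $\epsilon\in(0,1)$ is a small constant and $\beta:=1/\Theta(\epsilon^3)$. For $H\subseteq E$ and a vertex $x$, $\deg_x(H)$ is the number of edges of $H$ incident on $x$; for $e=(u,v)$, $\deg_e(H):=\deg_u(H)+\deg_v(H)$. An edge $e\in E$ is underfull w.r.t. $H$ iff $\deg_e(H)<(1-\epsilon)\beta$ and overfull iff $\deg_e(H)>\beta$. $H\subseteq E$ is an EDBS (edge degree bounded subgraph) of $G$ iff no edge of $H$ is overfull w.r.t. $H$. $\mu(\cdot)$ denotes maximum matching size. $\Theta(\epsilon)$ denotes a quantity bounded above and below by absolute constants times $\epsilon$. -}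

module Defs where

open import Data.Nat using (ℕ; zero; suc; _+_)
import Data.Nat
open import Data.Bool using (Bool; true; false; _∨_; _∧_; not; if_then_else_)
open import Data.Fin using (Fin)
open import Data.Integer using (+_)
open import Data.Product using (Σ; _×_; _,_)
open import Relation.Binary.PropositionalEquality using (_≡_)
open import Relation.Nullary using (¬_)
open import Data.Rational using (ℚ; _/_; _<_; _≤_; _-_; _*_; 1ℚ)

-- A bipartite graph with sides L = Fin nL, R = Fin nR.
-- An edge set (subset of L × R) is given by its indicator function.
EdgeSet : ℕ → ℕ → Set
EdgeSet nL nR = Fin nL → Fin nR → Bool

count : {n : ℕ} → (Fin n → Bool) → ℕ
count {zero}  f = 0
count {suc n} f = (if f Fin.zero then 1 else 0) + count (λ i → f (Fin.suc i))

_⊆ₑ_ : {nL nR : ℕ} → EdgeSet nL nR → EdgeSet nL nR → Set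
_⊆ₑ_ {nL} {nR} F F' = (x : Fin nL) (y : Fin nR) → F x y ≡ true → F' x y ≡ true

_∪ₑ_ : {nL nR : ℕ} → EdgeSet nL nR → EdgeSet nL nR → EdgeSet nL nR
(F ∪ₑ F') x y = F x y ∨ F' x y

degL : {nL nR : ℕ} → EdgeSet nL nR → Fin nL → ℕ
degL H x = count (λ y → H x y)

degR : {nL nR : ℕ} → EdgeSet nL nR → Fin nR → ℕ
degR H y = count (λ x → H x y)

degE : {nL nR : ℕ} → EdgeSet nL nR → Fin nL → Fin nR → ℕ
degE H x y = degL H x + degR H y

sumFin : {n : ℕ} → (Fin n → ℕ) → ℕ
sumFin {zero}  g = 0
sumFin {suc n} g = g Fin.zero + sumFin (λ i → g (Fin.suc i))

size : {nL nR : ℕ} → EdgeSet nL nR → ℕ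
size F = sumFin (λ x → degL F x)

toℚ : ℕ → ℚ
toℚ n = (+ n) / 1

IsMatchingIn : {nL nR : ℕ} → EdgeSet nL nR → EdgeSet nL nR → Set
IsMatchingIn {nL} {nR} M F =
  (M ⊆ₑ F) × ((x : Fin nL) → Data.Nat._≤_ (degL M x) 1)
           × ((y : Fin nR) → Data.Nat._≤_ (degR M y) 1)

IsMaxMatchingSize : {nL nR : ℕ} → EdgeSet nL nR → ℕ → Set
IsMaxMatchingSize {nL} {nR} F m =
  Σ (EdgeSet nL nR) (λ M → IsMatchingIn M F × size M ≡ m)
  × ((M : EdgeSet nL nR) → IsMatchingIn M F → Data.Nat._≤_ (size M) m)

Underfull : {nL nR : ℕ} → ℚ → ℚ → EdgeSet nL nR → Fin nL → Fin nR → Set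
Underfull ε β H x y = toℚ (degE H x y) < (1ℚ - ε) * β

Overfull : {nL nR : ℕ} → ℚ → EdgeSet nL nR → Fin nL → Fin nR → Set
Overfull β H x y = β < toℚ (degE H x y)

IsEDBS : {nL nR : ℕ} → ℚ → EdgeSet nL nR → EdgeSet nL nR → Set
IsEDBS {nL} {nR} β E H =
  (H ⊆ₑ E) × ((x : Fin nL) (y : Fin nR) → H x y ≡ true → ¬ Overfull β H x y)

-- Split a maximum matching M of G into the edges of H ∪ U, at most μ(H ∪ U) of them,
-- and the rest K.  An edge of K lies in E but neither in H nor in U, so it is not
-- underfull: deg_e(H) ≥ (1 - ε)β.  As K is a matching, summing deg_e(H) over K counts
-- every H-degree at most once, so (1 - ε)β|K| ≤ 2|H|.  A maximum matching of H covers
-- every edge of H, and a covered vertex has H-degree at most β because no edge of H is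
-- overfull; hence |H| ≤ 2βμ(H) and (1 - ε)|K| ≤ 4μ(H).  If μ(H) < εμ(G) then |K| is
-- O(ε)μ(G), and μ(G) ≤ μ(H ∪ U) + |K| yields μ(G) ≤ (1 + 10ε)μ(H ∪ U) for ε ≤ 1/12.
module Submission where

open import Defs
open import Data.Nat using (ℕ)
open import Data.Bool using (Bool; true; false)
open import Data.Fin using (Fin)
open import Data.Product using (Σ; _×_; _,_)
open import Data.Sum using (_⊎_; inj₁; inj₂)
open import Function.Bundles using (_⇔_)
open import Relation.Binary.PropositionalEquality using (_≡_)
open import Data.Rational using (ℚ; _<_; _≤_; _+_; _*_; 0ℚ; 1ℚ)

open import Algebra.Bundles using (CommutativeRing)
import Algebra.Properties.Semiring.Sum as SemiringSum
open import Data.Bool using (_∨_; _∧_; not; if_then_else_)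
import Data.Bool.Properties as Bool
open import Data.Empty using (⊥-elim)
import Data.Fin as Fin
open import Data.Integer as ℤ using (+_)
import Data.Integer.Properties as ℤ
open import Data.Nat as ℕ using (zero; suc; z≤n; s≤s)
import Data.Nat.Properties as ℕ
open import Data.Product using (∃; proj₁; proj₂)
open import Data.Rational using (_-_; -_; _/_; toℚᵘ; positive; nonNegative)
import Data.Rational.Properties as ℚ
open import Data.Rational.Solver using (module +-*-Solver)
import Data.Rational.Unnormalised as ℚᵘ
import Data.Rational.Unnormalised.Properties as ℚᵘ
open import Function.Base using (_∘_; case_of_)
open import Function.Bundles using (Equivalence)
open import Relation.Binary.PropositionalEquality
  using (refl; sym; trans; cong; cong₂; subst; subst₂; module ≡-Reasoning)
open import Relation.Nullary using (Dec; yes; no; does)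

-- Finite sums and counting

module ℕΣ = SemiringSum ℕ.+-*-semiring
open ℕΣ using (sum)

sumFin≡sum : ∀ {n} (f : Fin n → ℕ) → sumFin f ≡ sum f
sumFin≡sum {zero}  f = refl
sumFin≡sum {suc n} f = cong (f Fin.zero ℕ.+_) (sumFin≡sum (f ∘ Fin.suc))

sum-mono-≤ : ∀ {n} {f g : Fin n → ℕ} → (∀ i → f i ℕ.≤ g i) → sum f ℕ.≤ sum g
sum-mono-≤ {zero}  f≤g = z≤n
sum-mono-≤ {suc n} f≤g = ℕ.+-mono-≤ (f≤g Fin.zero) (sum-mono-≤ (f≤g ∘ Fin.suc))

indicator : Bool → ℕ
indicator b = if b then 1 else 0

count≡sum : ∀ {n} (f : Fin n → Bool) → count f ≡ sum (indicator ∘ f)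
count≡sum {zero}  f = refl
count≡sum {suc n} f = cong (indicator (f Fin.zero) ℕ.+_) (count≡sum (f ∘ Fin.suc))

count-cong : ∀ {n} {f g : Fin n → Bool} → (∀ i → f i ≡ g i) → count f ≡ count g
count-cong {f = f} {g} f≗g = begin
  count f                ≡⟨ count≡sum f ⟩
  sum (indicator ∘ f)    ≡⟨ ℕΣ.sum-cong-≗ (cong indicator ∘ f≗g) ⟩
  sum (indicator ∘ g)    ≡⟨ count≡sum g ⟨
  count g                ∎
  where open ≡-Reasoning

count-mono : ∀ {n} {f g : Fin n → Bool} → (∀ i → f i ≡ true → g i ≡ true) → count f ℕ.≤ count g
count-mono {f = f} {g} f⇒g = subst₂ ℕ._≤_ (sym (count≡sum f)) (sym (count≡sum g)) (sum-mono-≤ pointwise)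
  where
  pointwise : ∀ i → indicator (f i) ℕ.≤ indicator (g i)
  pointwise i with f i in fi
  ... | false = z≤n
  ... | true rewrite f⇒g i fi = ℕ.≤-refl

sum-if : ∀ {n} (f : Fin n → Bool) c → sum (λ i → if f i then c else 0) ≡ c ℕ.* count f
sum-if f c = begin
  sum (λ i → if f i then c else 0)       ≡⟨ ℕΣ.sum-cong-≗ (λ i → scale (f i)) ⟩
  sum (λ i → c ℕ.* indicator (f i))      ≡⟨ ℕΣ.*-distribˡ-sum c (indicator ∘ f) ⟨
  c ℕ.* sum (indicator ∘ f)              ≡⟨ cong (c ℕ.*_) (count≡sum f) ⟨
  c ℕ.* count f                          ∎
  where
  open ≡-Reasoning
  scale : ∀ b → (if b then c else 0) ≡ c ℕ.* indicator b
  scale true  = sym (ℕ.*-identityʳ c)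
  scale false = sym (ℕ.*-zeroʳ c)

count-disjoint-∨ : ∀ {n} {f g : Fin n → Bool} → (∀ i → g i ≡ true → f i ≡ false) →
  count (λ i → f i ∨ g i) ≡ count f ℕ.+ count g
count-disjoint-∨ {f = f} {g} disjoint = begin
  count (λ i → f i ∨ g i)                        ≡⟨ count≡sum (λ i → f i ∨ g i) ⟩
  sum (λ i → indicator (f i ∨ g i))              ≡⟨ ℕΣ.sum-cong-≗ pointwise ⟩
  sum (λ i → indicator (f i) ℕ.+ indicator (g i)) ≡⟨ ℕΣ.∑-distrib-+ (indicator ∘ f) (indicator ∘ g) ⟩
  sum (indicator ∘ f) ℕ.+ sum (indicator ∘ g)    ≡⟨ cong₂ ℕ._+_ (count≡sum f) (count≡sum g) ⟨
  count f ℕ.+ count g                            ∎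
  where
  open ≡-Reasoning
  pointwise : ∀ i → indicator (f i ∨ g i) ≡ indicator (f i) ℕ.+ indicator (g i)
  pointwise i with g i in gi
  ... | false rewrite Bool.∨-identityʳ (f i) = sym (ℕ.+-identityʳ _)
  ... | true rewrite disjoint i gi = refl

count-const-false : ∀ n → count {n} (λ _ → false) ≡ 0
count-const-false zero    = refl
count-const-false (suc n) = count-const-false n

count-∧ˡ : ∀ {n} b (f : Fin n → Bool) → count (λ i → b ∧ f i) ≡ (if b then count f else 0)
count-∧ˡ true  f = refl
count-∧ˡ {n} false f = count-const-false n

count-≟ : ∀ {n} (j : Fin n) → count (λ i → does (i Fin.≟ j)) ≡ 1
count-≟ {suc n} Fin.zero    = cong suc (count-const-false n)
count-≟ {suc n} (Fin.suc j) = count-≟ j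

count≡0⇒≡false : ∀ {n} (f : Fin n → Bool) → count f ≡ 0 → ∀ i → f i ≡ false
count≡0⇒≡false {suc n} f count≡0 i with f Fin.zero in f0
count≡0⇒≡false {suc n} f () i | true
count≡0⇒≡false {suc n} f count≡0 Fin.zero    | false = f0
count≡0⇒≡false {suc n} f count≡0 (Fin.suc i) | false = count≡0⇒≡false (f ∘ Fin.suc) count≡0 i

count>0⇒∃ : ∀ {n} (f : Fin n → Bool) → 1 ℕ.≤ count f → ∃ λ i → f i ≡ true
count>0⇒∃ {suc n} f count>0 with f Fin.zero in f0
... | true  = Fin.zero , f0
... | false with count>0⇒∃ (f ∘ Fin.suc) count>0
...   | i , fi = Fin.suc i , fi

-- Natural numbers as rationals

toℚᵘ-toℚ : ∀ n → toℚᵘ (toℚ n) ℚᵘ.≃ ℚᵘ.mkℚᵘ (+ n) 0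
toℚᵘ-toℚ n = ℚ.toℚᵘ-fromℚᵘ (ℚᵘ.mkℚᵘ (+ n) 0)

toℚ-+ : ∀ m n → toℚ (m ℕ.+ n) ≡ toℚ m + toℚ n
toℚ-+ m n = ℚ.toℚᵘ-injective (begin
  toℚᵘ (toℚ (m ℕ.+ n))                          ≈⟨ toℚᵘ-toℚ (m ℕ.+ n) ⟩
  ℚᵘ.mkℚᵘ (+ (m ℕ.+ n)) 0                       ≈⟨ ℚᵘ.*≡* (cong (ℤ._* + 1) integral) ⟩
  ℚᵘ.mkℚᵘ (+ m) 0 ℚᵘ.+ ℚᵘ.mkℚᵘ (+ n) 0         ≈⟨ ℚᵘ.+-cong (toℚᵘ-toℚ m) (toℚᵘ-toℚ n) ⟨
  toℚᵘ (toℚ m) ℚᵘ.+ toℚᵘ (toℚ n)                ≈⟨ ℚ.toℚᵘ-homo-+ (toℚ m) (toℚ n) ⟨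
  toℚᵘ (toℚ m + toℚ n)                          ∎)
  where
  open ℚᵘ.≃-Reasoning
  integral : + (m ℕ.+ n) ≡ + m ℤ.* + 1 ℤ.+ + n ℤ.* + 1
  integral = trans (ℤ.pos-+ m n) (sym (cong₂ ℤ._+_ (ℤ.*-identityʳ (+ m)) (ℤ.*-identityʳ (+ n))))

toℚ-mono-≤ : ∀ {m n} → m ℕ.≤ n → toℚ m ≤ toℚ n
toℚ-mono-≤ {m} {n} m≤n = ℚ.toℚᵘ-cancel-≤ (begin
  toℚᵘ (toℚ m)            ≃⟨ toℚᵘ-toℚ m ⟩
  ℚᵘ.mkℚᵘ (+ m) 0         ≤⟨ ℚᵘ.*≤* (ℤ.*-monoʳ-≤-nonNeg (+ 1) (ℤ.+≤+ m≤n)) ⟩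
  ℚᵘ.mkℚᵘ (+ n) 0         ≃⟨ toℚᵘ-toℚ n ⟨
  toℚᵘ (toℚ n)            ∎)
  where open ℚᵘ.≤-Reasoning

module ℚΣ = SemiringSum (CommutativeRing.semiring ℚ.+-*-commutativeRing)

toℚ-sum : ∀ {n} (f : Fin n → ℕ) → toℚ (sum f) ≡ ℚΣ.sum (toℚ ∘ f)
toℚ-sum {zero}  f = refl
toℚ-sum {suc n} f =
  trans (toℚ-+ (f Fin.zero) (sum (f ∘ Fin.suc))) (cong (λ s → toℚ (f Fin.zero) + s) (toℚ-sum (f ∘ Fin.suc)))

ℚsum-mono-≤ : ∀ {n} {f g : Fin n → ℚ} → (∀ i → f i ≤ g i) → ℚΣ.sum f ≤ ℚΣ.sum g
ℚsum-mono-≤ {zero}  f≤g = ℚ.≤-refl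
ℚsum-mono-≤ {suc n} f≤g = ℚ.+-mono-≤ (f≤g Fin.zero) (ℚsum-mono-≤ (f≤g ∘ Fin.suc))

*-toℚ-sum : ∀ {n} q (f : Fin n → ℕ) → q * toℚ (sum f) ≡ ℚΣ.sum (λ i → q * toℚ (f i))
*-toℚ-sum q f = trans (cong (q *_) (toℚ-sum f)) (ℚΣ.*-distribˡ-sum q (toℚ ∘ f))

toℚ-sum-≤-* : ∀ {n} q {f g : Fin n → ℕ} → (∀ i → toℚ (f i) ≤ q * toℚ (g i)) →
  toℚ (sum f) ≤ q * toℚ (sum g)
toℚ-sum-≤-* q {f} {g} f≤qg = subst₂ _≤_ (sym (toℚ-sum f)) (sym (*-toℚ-sum q g)) (ℚsum-mono-≤ f≤qg)

*-toℚ-sum-≤ : ∀ {n} q {f g : Fin n → ℕ} → (∀ i → q * toℚ (f i) ≤ toℚ (g i)) →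
  q * toℚ (sum f) ≤ toℚ (sum g)
*-toℚ-sum-≤ q {f} {g} qf≤g = subst₂ _≤_ (sym (*-toℚ-sum q f)) (sym (toℚ-sum g)) (ℚsum-mono-≤ qf≤g)

p≤q⇒0≤q-p : ∀ {p q} → p ≤ q → 0ℚ ≤ q - p
p≤q⇒0≤q-p {p} {q} p≤q = subst (_≤ q - p) (ℚ.+-inverseʳ p) (ℚ.+-monoˡ-≤ (- p) p≤q)

0≤q-p⇒p≤q : ∀ {p q} → 0ℚ ≤ q - p → p ≤ q
0≤q-p⇒p≤q {p} {q} 0≤q-p = subst₂ _≤_ (ℚ.+-identityˡ p) (cancel p q) (ℚ.+-monoˡ-≤ p 0≤q-p)
  where
  open +-*-Solver
  cancel : ∀ p q → (q - p) + p ≡ q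
  cancel = solve 2 (λ p q → (q :- p) :+ p := q) refl

*-nonNegative : ∀ {p q} → 0ℚ ≤ p → 0ℚ ≤ q → 0ℚ ≤ p * q
*-nonNegative {p} {q} 0≤p 0≤q =
  ℚ.nonNegative⁻¹ (p * q) {{ℚ.nonNeg*nonNeg⇒nonNeg p {{nonNegative 0≤p}} q {{nonNegative 0≤q}}}}

0≤toℚ : ∀ n → 0ℚ ≤ toℚ n
0≤toℚ n = ℚ.nonNegative⁻¹ (toℚ n) {{ℚ.normalize-nonNeg n 1}}

positive-factor : ∀ p {r} → 0ℚ < r → 0ℚ < p * r → 0ℚ < p
positive-factor p {r} 0<r 0<pr =
  ℚ.*-cancelʳ-<-nonNeg r {{ℚ.pos⇒nonNeg r {{positive 0<r}}}} (subst (_< p * r) (sym (ℚ.*-zeroˡ r)) 0<pr)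

*-positive : ∀ {p q} → 0ℚ < p → 0ℚ < q → 0ℚ < p * q
*-positive {p} {q} 0<p 0<q = ℚ.positive⁻¹ (p * q) {{ℚ.pos*pos⇒pos p {{positive 0<p}} q {{positive 0<q}}}}

∧≡true⇒ˡ : ∀ {b c} → b ∧ c ≡ true → b ≡ true
∧≡true⇒ˡ {true} _ = refl

∧≡true⇒ʳ : ∀ {b c} → b ∧ c ≡ true → c ≡ true
∧≡true⇒ʳ {true} c≡true = c≡true

-- Edge sets and matchings

private variable nL nR : ℕ

_∩ₑ_ _∖ₑ_ : EdgeSet nL nR → EdgeSet nL nR → EdgeSet nL nR
(F ∩ₑ F′) x y = F x y ∧ F′ x y
(F ∖ₑ F′) x y = F x y ∧ not (F′ x y)

-- degL (F ᵀ) is definitionally degR F, so each statement about right degrees is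
-- obtained from its left counterpart applied to transposes.
_ᵀ : EdgeSet nL nR → EdgeSet nR nL
(F ᵀ) y x = F x y

single : Fin nL → Fin nR → EdgeSet nL nR
single x y x′ y′ = does (x′ Fin.≟ x) ∧ does (y′ Fin.≟ y)

Disjoint : EdgeSet nL nR → EdgeSet nL nR → Set
Disjoint F F′ = ∀ x y → F′ x y ≡ true → F x y ≡ false

restrictTo : EdgeSet nL nR → (Fin nL → Fin nR → ℕ) → Fin nL → Fin nR → ℕ
restrictTo F w x y = if F x y then w x y else 0

edgeSum : EdgeSet nL nR → (Fin nL → Fin nR → ℕ) → ℕ
edgeSum F w = sum λ x → sum (restrictTo F w x)

size≡sum-degL : (F : EdgeSet nL nR) → size F ≡ sum (degL F)
size≡sum-degL F = sumFin≡sum (degL F)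

size≡edgeSum-1 : (F : EdgeSet nL nR) → size F ≡ edgeSum F (λ _ _ → 1)
size≡edgeSum-1 F = trans (size≡sum-degL F) (ℕΣ.sum-cong-≗ (λ x → count≡sum (F x)))

edgeSum-ᵀ : (F : EdgeSet nL nR) (w : Fin nL → Fin nR → ℕ) → edgeSum (F ᵀ) (λ y x → w x y) ≡ edgeSum F w
edgeSum-ᵀ F w = ℕΣ.∑-comm (restrictTo (F ᵀ) (λ y x → w x y))

size≡sum-degR : (F : EdgeSet nL nR) → size F ≡ sum (degR F)
size≡sum-degR F = begin
  size F                       ≡⟨ size≡edgeSum-1 F ⟩
  edgeSum F (λ _ _ → 1)        ≡⟨ edgeSum-ᵀ F (λ _ _ → 1) ⟨
  edgeSum (F ᵀ) (λ _ _ → 1)    ≡⟨ size≡edgeSum-1 (F ᵀ) ⟨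
  size (F ᵀ)                   ≡⟨ size≡sum-degL (F ᵀ) ⟩
  sum (degR F)                 ∎
  where open ≡-Reasoning

edgeSum-mono-≤ : (F : EdgeSet nL nR) {w w′ : Fin nL → Fin nR → ℕ} →
  (∀ x y → F x y ≡ true → w x y ℕ.≤ w′ x y) → edgeSum F w ℕ.≤ edgeSum F w′
edgeSum-mono-≤ F {w} {w′} w≤w′ = sum-mono-≤ λ x → sum-mono-≤ λ y → pointwise x y
  where
  pointwise : ∀ x y → restrictTo F w x y ℕ.≤ restrictTo F w′ x y
  pointwise x y with F x y in Fxy
  ... | true  = w≤w′ x y Fxy
  ... | false = z≤n

edgeSum-+ : (F : EdgeSet nL nR) (w w′ : Fin nL → Fin nR → ℕ) →
  edgeSum F (λ x y → w x y ℕ.+ w′ x y) ≡ edgeSum F w ℕ.+ edgeSum F w′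
edgeSum-+ F w w′ = begin
  edgeSum F (λ x y → w x y ℕ.+ w′ x y)
    ≡⟨ ℕΣ.sum-cong-≗ (λ x → trans (ℕΣ.sum-cong-≗ (λ y → split (F x y))) (ℕΣ.∑-distrib-+ (restrictTo F w x) (restrictTo F w′ x))) ⟩
  sum (λ x → sum (restrictTo F w x) ℕ.+ sum (restrictTo F w′ x))
    ≡⟨ ℕΣ.∑-distrib-+ (λ x → sum (restrictTo F w x)) (λ x → sum (restrictTo F w′ x)) ⟩
  edgeSum F w ℕ.+ edgeSum F w′
    ∎
  where
  open ≡-Reasoning
  split : ∀ {m n} b → (if b then m ℕ.+ n else 0) ≡ (if b then m else 0) ℕ.+ (if b then n else 0)
  split true  = refl
  split false = refl

edgeSum-degL : (F : EdgeSet nL nR) (a : Fin nL → ℕ) → edgeSum F (λ x _ → a x) ≡ sum (λ x → a x ℕ.* degL F x)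
edgeSum-degL F a = ℕΣ.sum-cong-≗ (λ x → sum-if (F x) (a x))

edgeSum-degR : (F : EdgeSet nL nR) (b : Fin nR → ℕ) → edgeSum F (λ _ y → b y) ≡ sum (λ y → b y ℕ.* degR F y)
edgeSum-degR F b = trans (sym (edgeSum-ᵀ F (λ _ y → b y))) (edgeSum-degL (F ᵀ) b)

handshake : (F : EdgeSet nL nR) (a : Fin nL → ℕ) (b : Fin nR → ℕ) →
  edgeSum F (λ x y → a x ℕ.+ b y) ≡ sum (λ x → a x ℕ.* degL F x) ℕ.+ sum (λ y → b y ℕ.* degR F y)
handshake F a b = trans (edgeSum-+ F (λ x _ → a x) (λ _ y → b y)) (cong₂ ℕ._+_ (edgeSum-degL F a) (edgeSum-degR F b))

size-cong : {F F′ : EdgeSet nL nR} → (∀ x y → F x y ≡ F′ x y) → size F ≡ size F′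
size-cong {F = F} {F′} F≗F′ = begin
  size F          ≡⟨ size≡sum-degL F ⟩
  sum (degL F)    ≡⟨ ℕΣ.sum-cong-≗ (λ x → count-cong (F≗F′ x)) ⟩
  sum (degL F′)   ≡⟨ size≡sum-degL F′ ⟨
  size F′         ∎
  where open ≡-Reasoning

size-∪ : (F F′ : EdgeSet nL nR) → Disjoint F F′ → size (F ∪ₑ F′) ≡ size F ℕ.+ size F′
size-∪ F F′ disjoint = begin
  size (F ∪ₑ F′)                       ≡⟨ size≡sum-degL (F ∪ₑ F′) ⟩
  sum (degL (F ∪ₑ F′))                 ≡⟨ ℕΣ.sum-cong-≗ (λ x → count-disjoint-∨ (disjoint x)) ⟩
  sum (λ x → degL F x ℕ.+ degL F′ x)   ≡⟨ ℕΣ.∑-distrib-+ (degL F) (degL F′) ⟩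
  sum (degL F) ℕ.+ sum (degL F′)       ≡⟨ cong₂ ℕ._+_ (size≡sum-degL F) (size≡sum-degL F′) ⟨
  size F ℕ.+ size F′                   ∎
  where open ≡-Reasoning

size-∩-∖ : (M F : EdgeSet nL nR) → size M ≡ size (M ∩ₑ F) ℕ.+ size (M ∖ₑ F)
size-∩-∖ M F = trans (size-cong (λ x y → split (M x y) (F x y))) (size-∪ (M ∩ₑ F) (M ∖ₑ F) disjoint)
  where
  split : ∀ b c → b ≡ (b ∧ c) ∨ (b ∧ not c)
  split false c     = refl
  split true  true  = refl
  split true  false = refl
  disjoint : Disjoint (M ∩ₑ F) (M ∖ₑ F)
  disjoint x y M∖F with M x y | F x y
  ... | true  | false = refl
  ... | false | _     = refl

isMatchingIn-⊆ : {M M′ F F′ : EdgeSet nL nR} → IsMatchingIn M F → M′ ⊆ₑ M → M′ ⊆ₑ F′ → IsMatchingIn M′ F′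
isMatchingIn-⊆ (_ , degL≤1 , degR≤1) M′⊆M M′⊆F′ =
  M′⊆F′ ,
  (λ x → ℕ.≤-trans (count-mono (M′⊆M x)) (degL≤1 x)) ,
  (λ y → ℕ.≤-trans (count-mono (λ x → M′⊆M x y)) (degR≤1 y))

isMatchingIn-ᵀ : {M F : EdgeSet nL nR} → IsMatchingIn M F → IsMatchingIn (M ᵀ) (F ᵀ)
isMatchingIn-ᵀ (M⊆F , degL≤1 , degR≤1) = (λ y x → M⊆F x y) , degR≤1 , degL≤1

single-true : (x : Fin nL) (y : Fin nR) (x′ : Fin nL) (y′ : Fin nR) → single x y x′ y′ ≡ true → x′ ≡ x × y′ ≡ y
single-true x y x′ y′ e with x′ Fin.≟ x | y′ Fin.≟ y
... | yes x′≡x | yes y′≡y = x′≡x , y′≡y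

degL-single : (x : Fin nL) (y : Fin nR) (x′ : Fin nL) → degL (single x y) x′ ≡ indicator (does (x′ Fin.≟ x))
degL-single x y x′ =
  trans (count-∧ˡ (does (x′ Fin.≟ x)) (λ y′ → does (y′ Fin.≟ y)))
        (cong (λ c → if does (x′ Fin.≟ x) then c else 0) (count-≟ y))

degR-single : (x : Fin nL) (y : Fin nR) (y′ : Fin nR) → degR (single x y) y′ ≡ indicator (does (y′ Fin.≟ y))
degR-single x y y′ = trans (count-cong (λ x′ → Bool.∧-comm (does (x′ Fin.≟ x)) _)) (degL-single y x y′)

size-single : (x : Fin nL) (y : Fin nR) → size (single x y) ≡ 1
size-single x y = begin
  size (single x y)                          ≡⟨ size≡sum-degL (single x y) ⟩
  sum (degL (single x y))                    ≡⟨ ℕΣ.sum-cong-≗ (degL-single x y) ⟩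
  sum (λ x′ → indicator (does (x′ Fin.≟ x))) ≡⟨ count≡sum (λ x′ → does (x′ Fin.≟ x)) ⟨
  count (λ x′ → does (x′ Fin.≟ x))           ≡⟨ count-≟ x ⟩
  1                                          ∎
  where open ≡-Reasoning

degL-∪-≤1 : (M S : EdgeSet nL nR) (x : Fin nL) → Disjoint M S →
  (∀ x′ → degL M x′ ℕ.≤ 1) → degL M x ≡ 0 → (∀ x′ → degL S x′ ≡ indicator (does (x′ Fin.≟ x))) →
  ∀ x′ → degL (M ∪ₑ S) x′ ℕ.≤ 1
degL-∪-≤1 M S x disjoint degL≤1 x-free degS x′ = begin
  degL (M ∪ₑ S) x′                              ≡⟨ count-disjoint-∨ (disjoint x′) ⟩
  degL M x′ ℕ.+ degL S x′                       ≡⟨ cong (degL M x′ ℕ.+_) (degS x′) ⟩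
  degL M x′ ℕ.+ indicator (does (x′ Fin.≟ x))   ≤⟨ bound (x′ Fin.≟ x) ⟩
  1                                             ∎
  where
  open ℕ.≤-Reasoning
  bound : (d : Dec (x′ ≡ x)) → degL M x′ ℕ.+ indicator (does d) ℕ.≤ 1
  bound (yes x′≡x) = ℕ.≤-reflexive (cong (ℕ._+ 1) (subst (λ z → degL M z ≡ 0) (sym x′≡x) x-free))
  bound (no _)     = subst (ℕ._≤ 1) (sym (ℕ.+-identityʳ (degL M x′))) (degL≤1 x′)

module _ {M F : EdgeSet nL nR} (M-matching : IsMatchingIn M F) {x : Fin nL} {y : Fin nR}
         (Fxy : F x y ≡ true) (x-free : degL M x ≡ 0) (y-free : degR M y ≡ 0) where

  private
    disjoint : Disjoint M (single x y)
    disjoint x′ y′ e with single-true x y x′ y′ e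
    ... | refl , refl = count≡0⇒≡false (M x) x-free y

  isMatchingIn-∪-single : IsMatchingIn (M ∪ₑ single x y) F
  isMatchingIn-∪-single =
    M∪S⊆F ,
    degL-∪-≤1 M (single x y) x disjoint (proj₁ (proj₂ M-matching)) x-free (degL-single x y) ,
    degL-∪-≤1 (M ᵀ) (single x y ᵀ) y (λ y′ x′ → disjoint x′ y′) (proj₂ (proj₂ M-matching)) y-free (degR-single x y)
    where
    M∪S⊆F : (M ∪ₑ single x y) ⊆ₑ F
    M∪S⊆F x′ y′ e with M x′ y′ in Mx′y′
    ... | true  = proj₁ M-matching x′ y′ Mx′y′
    ... | false with single-true x y x′ y′ e
    ...   | refl , refl = Fxy

  size-∪-single : size (M ∪ₑ single x y) ≡ suc (size M)
  size-∪-single = trans (size-∪ M (single x y) disjoint) (trans (cong (size M ℕ.+_) (size-single x y)) (ℕ.+-comm (size M) 1))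

maximumMatching-covers : {M H : EdgeSet nL nR} → IsMatchingIn M H →
  (∀ M′ → IsMatchingIn M′ H → size M′ ℕ.≤ size M) →
  ∀ x y → H x y ≡ true → 1 ℕ.≤ degL M x ℕ.+ degR M y
maximumMatching-covers {M = M} M-matching maximum x y Hxy with degL M x in x-free | degR M y in y-free
... | suc _ | _     = s≤s z≤n
... | zero  | suc _ = s≤s z≤n
... | zero  | zero  = ⊥-elim (ℕ.1+n≰n (subst (ℕ._≤ size M) (size-∪-single M-matching Hxy x-free y-free)
                                                 (maximum _ (isMatchingIn-∪-single M-matching Hxy x-free y-free))))

toℚ-degL*degL-≤ : {M H : EdgeSet nL nR} (β : ℚ) → M ⊆ₑ H → (∀ x y → H x y ≡ true → toℚ (degL H x) ≤ β) →
  ∀ x → degL M x ℕ.≤ 1 → toℚ (degL M x ℕ.* degL H x) ≤ β * toℚ (degL M x)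
toℚ-degL*degL-≤ {M = M} {H} β M⊆H H-bounded x degL≤1 with degL M x in degM | degL≤1
... | zero  | _ = ℚ.≤-reflexive (sym (ℚ.*-zeroʳ β))
... | suc zero | _ =
  let y , Mxy = count>0⇒∃ (M x) (ℕ.≤-reflexive (sym degM))
  in subst₂ _≤_ (cong toℚ (sym (ℕ.*-identityˡ (degL H x)))) (sym (ℚ.*-identityʳ β)) (H-bounded x y (M⊆H x y Mxy))
... | suc (suc _) | s≤s ()

noOverfull⇒size-≤ : {H : EdgeSet nL nR} {m : ℕ} (β : ℚ) → (∀ x y → H x y ≡ true → toℚ (degE H x y) ≤ β) →
  IsMaxMatchingSize H m → toℚ (size H) ≤ β * toℚ m + β * toℚ m
noOverfull⇒size-≤ {H = H} β noOverfull ((M , M-matching , refl) , maximum) = begin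
  toℚ (size H)                                   ≤⟨ toℚ-mono-≤ covered ⟩
  toℚ (weightL ℕ.+ weightR)                      ≡⟨ toℚ-+ weightL weightR ⟩
  toℚ weightL + toℚ weightR                      ≤⟨ ℚ.+-mono-≤ left right ⟩
  β * toℚ (sum (degL M)) + β * toℚ (sum (degR M))
    ≡⟨ cong₂ (λ a b → β * toℚ a + β * toℚ b) (size≡sum-degL M) (size≡sum-degR M) ⟨
  β * toℚ (size M) + β * toℚ (size M)            ∎
  where
  open ℚ.≤-Reasoning
  weightL weightR : ℕ
  weightL = sum (λ x → degL M x ℕ.* degL H x)
  weightR = sum (λ y → degR M y ℕ.* degR H y)
  covered : size H ℕ.≤ weightL ℕ.+ weightR
  covered = subst₂ ℕ._≤_ (sym (size≡edgeSum-1 H)) (handshake H (degL M) (degR M))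
    (edgeSum-mono-≤ H (maximumMatching-covers M-matching maximum))
  left : toℚ weightL ≤ β * toℚ (sum (degL M))
  left = toℚ-sum-≤-* β λ x → toℚ-degL*degL-≤ β (proj₁ M-matching)
    (λ x y Hxy → ℚ.≤-trans (toℚ-mono-≤ (ℕ.m≤m+n (degL H x) (degR H y))) (noOverfull x y Hxy))
    x (proj₁ (proj₂ M-matching) x)
  right : toℚ weightR ≤ β * toℚ (sum (degR M))
  right = toℚ-sum-≤-* β λ y → toℚ-degL*degL-≤ β (proj₁ (isMatchingIn-ᵀ M-matching))
    (λ y x Hxy → ℚ.≤-trans (toℚ-mono-≤ (ℕ.m≤n+m (degR H y) (degL H x))) (noOverfull x y Hxy))
    y (proj₂ (proj₂ M-matching) y)

*-size-≤-edgeSum : (F : EdgeSet nL nR) (w : Fin nL → Fin nR → ℕ) (q : ℚ) →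
  (∀ x y → F x y ≡ true → q ≤ toℚ (w x y)) → q * toℚ (size F) ≤ toℚ (edgeSum F w)
*-size-≤-edgeSum F w q q≤w = subst (λ s → q * toℚ s ≤ toℚ (edgeSum F w)) (sym (size≡edgeSum-1 F))
  (*-toℚ-sum-≤ q λ x → *-toℚ-sum-≤ q λ y → pointwise x y)
  where
  pointwise : ∀ x y → q * toℚ (restrictTo F (λ _ _ → 1) x y) ≤ toℚ (restrictTo F w x y)
  pointwise x y with F x y in Fxy
  ... | true  = subst (_≤ toℚ (w x y)) (sym (ℚ.*-identityʳ q)) (q≤w x y Fxy)
  ... | false = ℚ.≤-reflexive (ℚ.*-zeroʳ q)

matching-edgeSum-degE-≤ : {K : EdgeSet nL nR} (H : EdgeSet nL nR) →
  (∀ x → degL K x ℕ.≤ 1) → (∀ y → degR K y ℕ.≤ 1) → edgeSum K (degE H) ℕ.≤ size H ℕ.+ size H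
matching-edgeSum-degE-≤ {K = K} H degL≤1 degR≤1 = begin
  edgeSum K (degE H)                                                       ≡⟨ handshake K (degL H) (degR H) ⟩
  sum (λ x → degL H x ℕ.* degL K x) ℕ.+ sum (λ y → degR H y ℕ.* degR K y)  ≤⟨ ℕ.+-mono-≤ (sum-mono-≤ (λ x → *≤ (degL≤1 x)))
                                                                                             (sum-mono-≤ (λ y → *≤ (degR≤1 y))) ⟩
  sum (degL H) ℕ.+ sum (degR H)                                            ≡⟨ cong₂ ℕ._+_ (size≡sum-degL H) (size≡sum-degR H) ⟨
  size H ℕ.+ size H                                                        ∎
  where
  open ℕ.≤-Reasoning
  *≤ : ∀ {m k} → k ℕ.≤ 1 → m ℕ.* k ℕ.≤ m
  *≤ {m} k≤1 = subst (m ℕ.* _ ℕ.≤_) (ℕ.*-identityʳ m) (ℕ.*-monoʳ-≤ m k≤1)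

heavyMatching-size-≤ : {H K : EdgeSet nL nR} {m : ℕ} (β c : ℚ) → 0ℚ < β →
  (∀ x y → H x y ≡ true → toℚ (degE H x y) ≤ β) → IsMaxMatchingSize H m →
  (∀ x → degL K x ℕ.≤ 1) → (∀ y → degR K y ℕ.≤ 1) → (∀ x y → K x y ≡ true → c * β ≤ toℚ (degE H x y)) →
  c * toℚ (size K) ≤ (toℚ m + toℚ m) + (toℚ m + toℚ m)
heavyMatching-size-≤ {H = H} {K} {m} β c β>0 noOverfull μH=m degL≤1 degR≤1 heavy =
  ℚ.*-cancelˡ-≤-pos β {{positive β>0}} (begin
    β * (c * toℚ (size K))                              ≡⟨ rearrange β c (toℚ (size K)) ⟩
    (c * β) * toℚ (size K)                              ≤⟨ *-size-≤-edgeSum K (degE H) (c * β) heavy ⟩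
    toℚ (edgeSum K (degE H))                            ≤⟨ toℚ-mono-≤ (matching-edgeSum-degE-≤ H degL≤1 degR≤1) ⟩
    toℚ (size H ℕ.+ size H)                             ≡⟨ toℚ-+ (size H) (size H) ⟩
    toℚ (size H) + toℚ (size H)                         ≤⟨ ℚ.+-mono-≤ size-≤ size-≤ ⟩
    (β * toℚ m + β * toℚ m) + (β * toℚ m + β * toℚ m)   ≡⟨ factor β (toℚ m) ⟩
    β * ((toℚ m + toℚ m) + (toℚ m + toℚ m))             ∎)
  where
  open ℚ.≤-Reasoning
  open +-*-Solver
  size-≤ : toℚ (size H) ≤ β * toℚ m + β * toℚ m
  size-≤ = noOverfull⇒size-≤ β noOverfull μH=m
  rearrange : ∀ b c k → b * (c * k) ≡ (c * b) * k
  rearrange = solve 3 (λ b c k → b :* (c :* k) := (c :* b) :* k) refl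
  factor : ∀ b h → (b * h + b * h) + (b * h + b * h) ≡ b * ((h + h) + (h + h))
  factor = solve 2 (λ b h → (b :* h :+ b :* h) :+ (b :* h :+ b :* h) := b :* ((h :+ h) :+ (h :+ h))) refl

-- The heavy remainder of a maximum matching of G

outside-H∪U⇒heavy : {E H U : EdgeSet nL nR} {ε β : ℚ} →
  (∀ x y → (U x y ≡ true) ⇔ ((E x y ≡ true) × (H x y ≡ false) × Underfull ε β H x y)) →
  ∀ x y → E x y ≡ true → (H ∪ₑ U) x y ≡ false → (1ℚ - ε) * β ≤ toℚ (degE H x y)
outside-H∪U⇒heavy {H = H} {U} U-spec x y Exy H∪U-false with H x y in Hxy | U x y in Uxy
... | false | false = ℚ.≮⇒≥ λ underfull → case trans (sym (Equivalence.from (U-spec x y) (Exy , Hxy , underfull))) Uxy of λ ()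

matching-split : {E H U M : EdgeSet nL nR} {ε β : ℚ} {mH mHU : ℕ} → 0ℚ < β → IsEDBS β E H →
  (∀ x y → (U x y ≡ true) ⇔ ((E x y ≡ true) × (H x y ≡ false) × Underfull ε β H x y)) →
  IsMatchingIn M E → IsMaxMatchingSize H mH → IsMaxMatchingSize (H ∪ₑ U) mHU →
  Σ ℕ λ k → (size M ℕ.≤ mHU ℕ.+ k) × ((1ℚ - ε) * toℚ k ≤ (toℚ mH + toℚ mH) + (toℚ mH + toℚ mH))
matching-split {E = E} {H} {U} {M} {ε} {β} {mHU = mHU} β>0 (_ , noOverfull) U-spec M-matching μH=mH (_ , maximumHU) =
  size K ,
  subst (ℕ._≤ mHU ℕ.+ size K) (sym (size-∩-∖ M (H ∪ₑ U))) (ℕ.+-monoˡ-≤ (size K) (maximumHU (M ∩ₑ (H ∪ₑ U)) P-matching)) ,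
  heavyMatching-size-≤ β (1ℚ - ε) β>0 (λ x y Hxy → ℚ.≮⇒≥ (noOverfull x y Hxy)) μH=mH
    (proj₁ (proj₂ K-matching)) (proj₂ (proj₂ K-matching)) K-heavy
  where
  K : EdgeSet _ _
  K = M ∖ₑ (H ∪ₑ U)
  P-matching : IsMatchingIn (M ∩ₑ (H ∪ₑ U)) (H ∪ₑ U)
  P-matching = isMatchingIn-⊆ M-matching (λ _ _ → ∧≡true⇒ˡ) (λ _ _ → ∧≡true⇒ʳ)
  K-matching : IsMatchingIn K E
  K-matching = isMatchingIn-⊆ M-matching (λ _ _ → ∧≡true⇒ˡ) (λ x y Kxy → proj₁ M-matching x y (∧≡true⇒ˡ Kxy))
  K-heavy : ∀ x y → K x y ≡ true → (1ℚ - ε) * β ≤ toℚ (degE H x y)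
  K-heavy x y Kxy = outside-H∪U⇒heavy {ε = ε} {β} U-spec x y (proj₁ M-matching x y (∧≡true⇒ˡ Kxy))
                                      (Bool.not-injective {y = false} (∧≡true⇒ʳ Kxy))

ε₀ C : ℚ
ε₀ = + 1 / 12
C  = toℚ 10

combine-bounds : ∀ {ε g u k h} → 0ℚ ≤ ε → ε ≤ ε₀ → 0ℚ ≤ g → 0ℚ ≤ k →
  g ≤ u + k → (1ℚ - ε) * k ≤ (h + h) + (h + h) → h ≤ ε * g → g ≤ (1ℚ + C * ε) * u
combine-bounds {ε} {g} {u} {k} {h} 0≤ε ε≤ε₀ 0≤g 0≤k g≤u+k k-bound h≤εg =
  0≤q-p⇒p≤q (subst (0ℚ ≤_) (sym (certificate ε g u k h))
    (ℚ.+-mono-≤ (ℚ.+-mono-≤ (ℚ.+-mono-≤ (ℚ.+-mono-≤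
      (*-nonNegative 0≤1+Cε (p≤q⇒0≤q-p g≤u+k))
      (*-nonNegative (0≤toℚ 2) (*-nonNegative 0≤ε 0≤g)))
      (*-nonNegative (0≤toℚ 8) (p≤q⇒0≤q-p h≤εg)))
      (*-nonNegative (0≤toℚ 2) (p≤q⇒0≤q-p k-bound)))
      (*-nonNegative 0≤1-12ε 0≤k)))
  where
  open +-*-Solver
  -- (1 + Cε)u - g as a nonnegative combination of the slacks of the hypotheses.
  certificate : ∀ ε g u k h → (1ℚ + C * ε) * u - g ≡
    (1ℚ + C * ε) * ((u + k) - g) + toℚ 2 * (ε * g) + toℚ 8 * (ε * g - h)
      + toℚ 2 * (((h + h) + (h + h)) - (1ℚ - ε) * k) + (1ℚ - toℚ 12 * ε) * k
  certificate = solve 5 (λ ε g u k h → (con 1ℚ :+ con C :* ε) :* u :- g :=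
    (con 1ℚ :+ con C :* ε) :* ((u :+ k) :- g) :+ con (toℚ 2) :* (ε :* g) :+ con (toℚ 8) :* (ε :* g :- h)
      :+ con (toℚ 2) :* (((h :+ h) :+ (h :+ h)) :- (con 1ℚ :- ε) :* k) :+ (con 1ℚ :- con (toℚ 12) :* ε) :* k) refl
  0≤1+Cε : 0ℚ ≤ 1ℚ + C * ε
  0≤1+Cε = ℚ.+-mono-≤ (0≤toℚ 1) (*-nonNegative (0≤toℚ 10) 0≤ε)
  0≤1-12ε : 0ℚ ≤ 1ℚ - toℚ 12 * ε
  0≤1-12ε = p≤q⇒0≤q-p (ℚ.*-monoˡ-≤-nonNeg (toℚ 12) ε≤ε₀)

claim5p3 :
    Σ ℚ λ ε₀ → Σ ℚ λ a → Σ ℚ λ b → Σ ℚ λ C →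
      (0ℚ < ε₀) × (0ℚ < a) × (a ≤ b) × (0ℚ < C) ×
      ((ε : ℚ) → 0ℚ < ε → ε < 1ℚ → ε ≤ ε₀ →
       (β : ℚ) → a ≤ β * (ε * ε * ε) → β * (ε * ε * ε) ≤ b →
       (nL nR : ℕ) (E H U : EdgeSet nL nR) →
       IsEDBS β E H →
       ((x : Fin nL) (y : Fin nR) →
          (U x y ≡ true) ⇔ ((E x y ≡ true) × (H x y ≡ false) × Underfull ε β H x y)) →
       (mG mH mHU : ℕ) →
       IsMaxMatchingSize E mG → IsMaxMatchingSize H mH → IsMaxMatchingSize (H ∪ₑ U) mHU →
       (ε * toℚ mG ≤ toℚ mH) ⊎ (toℚ mG ≤ (1ℚ + C * ε) * toℚ mHU))
claim5p3 =
  ε₀ , 1ℚ , 1ℚ , C ,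
  ℚ.positive⁻¹ ε₀ , ℚ.positive⁻¹ 1ℚ , ℚ.≤-refl , ℚ.positive⁻¹ C ,
  λ { ε 0<ε _ ε≤ε₀ β 1≤βε³ _ nL nR E H U H-edbs U-spec mG mH mHU ((M , M-matching , refl) , _) μH=mH μH∪U=mHU →
    let 0<β = positive-factor β (*-positive (*-positive 0<ε 0<ε) 0<ε)
                (ℚ.<-≤-trans (ℚ.positive⁻¹ 1ℚ) 1≤βε³)
        k , size≤mHU+k , k-bound = matching-split {ε = ε} 0<β H-edbs U-spec M-matching μH=mH μH∪U=mHU
    in case ε * toℚ (size M) ℚ.≤? toℚ mH of λ
      { (yes small) → inj₁ small
      ; (no large)  → inj₂ (combine-bounds (ℚ.<⇒≤ 0<ε) ε≤ε₀ (0≤toℚ (size M)) (0≤toℚ k)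
                        (ℚ.≤-trans (toℚ-mono-≤ size≤mHU+k) (ℚ.≤-reflexive (toℚ-+ mHU k)))
                        k-bound (ℚ.<⇒≤ (ℚ.≰⇒> large))) } }
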